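{- Let $G$ be a graph and let $A\subseteq V(G)$ be a clique of $G$. Then for every graph $H$, \[ I((G,A)\circ H;x)=I(H;x)^{|A|-1}\cdot I((G,A)+H;x). \]
   Context: All graphs are finite and simple. For a graph $G$, $I(G;x)=\sum_{k\ge0}s_kx^k$ where $s_k$ is the number of independent sets (sets of pairwise non-adjacent vertices) of size $k$. The corona $(G,A)\circ H$ is the graph obtained from $G$ and $|A|$ disjoint copies of $H$ by joining each vertex of $A$ to all vertices of its own copy of $H$ (a distinct copy for each vertex of $A$). $(G,A)+H$ denotes the Zykov sum of $G$ and a disjoint copy of $H$ with respect to $A$ and $V(H)$: its vertex set is $V(G)\cup V(H)$ and its edges are those of $G$, those of $H$, and all edges $ah$ with $a\in A$, $h\in V(H)$. -}

module Defs where

open import Data.Bool using (Bool; true; false; _∧_; _∨_; not)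
open import Data.Nat using (ℕ; zero; suc; _+_; _*_; _∸_)
open import Data.Fin using (Fin; splitAt; remQuot; _≟_)
open import Data.Fin.Subset using (Subset; _∈_; ∣_∣)
open import Data.Fin.Subset.Properties using (_∈?_)
open import Data.Fin.Properties using (all?; any?)
open import Data.List using (List; []; _∷_; map; _++_; length; filter; upTo)
open import Data.Nat.ListAction using (sum)
open import Data.Vec using (Vec; []; _∷_)
open import Data.Product using (_×_; _,_)
open import Data.Sum using (_⊎_; inj₁; inj₂)
open import Relation.Nullary using (Dec; ¬_; does)
open import Relation.Nullary.Decidable using (_×-dec_; _→-dec_)
open import Relation.Binary.PropositionalEquality using (_≡_; _≢_)
open import Function.Definitions using (Injective)

record Graph : Set where
  constructor mkGraph
  field
    n   : ℕ
    adj : Fin n → Fin n → Bool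
open Graph public

IsSimple : Graph → Set
IsSimple G = (∀ u v → adj G u v ≡ adj G v u) × (∀ u → adj G u u ≡ false)

Independent : (G : Graph) → Subset (n G) → Set
Independent G S = ∀ u v → u ∈ S → v ∈ S → adj G u v ≡ false

independent? : (G : Graph) (S : Subset (n G)) → Dec (Independent G S)
independent? G S =
  all? λ u → all? λ v → (u ∈? S) →-dec ((v ∈? S) →-dec (Data.Bool._≟_ (adj G u v) false))
  where import Data.Bool

allSubsets : ∀ m → List (Subset m)
allSubsets zero    = [] ∷ []
allSubsets (suc m) = map (false ∷_) (allSubsets m) ++ map (true ∷_) (allSubsets m)

Poly : Set
Poly = ℕ → ℕ

indPoly : Graph → Poly
indPoly G k = length (filter (λ S → (∣ S ∣ Data.Nat.≟ k) ×-dec independent? G S) (allSubsets (n G)))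
  where import Data.Nat

_*P_ : Poly → Poly → Poly
(p *P q) k = sum (map (λ i → p i * q (k ∸ i)) (upTo (suc k)))

oneP : Poly
oneP zero    = 1
oneP (suc _) = 0

_^P_ : Poly → ℕ → Poly
p ^P zero  = oneP
p ^P suc e = p *P (p ^P e)

_≈P_ : Poly → Poly → Set
p ≈P q = ∀ k → p k ≡ q k

-- A vertex subset A ⊆ V(G) with |A| = k is given by an injective
-- enumeration a : Fin k → Fin (n G) of its elements.

IsClique : (G : Graph) {k : ℕ} → (Fin k → Fin (n G)) → Set
IsClique G a = ∀ i j → i ≢ j → adj G (a i) (a j) ≡ true

-- Corona (G,A) ∘ H : vertices Fin (n G + k * n H);
--   inj₁ u          ~ vertex u of G
--   inj₂ (i , h)    ~ vertex h of the copy of H attached to a i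

coronaView : ∀ {N k m} → Fin (N + k * m) → Fin N ⊎ (Fin k × Fin m)
coronaView {N} {k} {m} x with splitAt N x
... | inj₁ u = inj₁ u
... | inj₂ y = inj₂ (remQuot m y)

corona : (G : Graph) {k : ℕ} → (Fin k → Fin (n G)) → Graph → Graph
corona G {k} a H = mkGraph (n G + k * n H) ad
  where
  ad : Fin (n G + k * n H) → Fin (n G + k * n H) → Bool
  ad x y with coronaView {n G} {k} {n H} x | coronaView {n G} {k} {n H} y
  ... | inj₁ u       | inj₁ v       = adj G u v
  ... | inj₁ u       | inj₂ (j , h) = does (u ≟ a j)
  ... | inj₂ (i , h) | inj₁ v       = does (v ≟ a i)
  ... | inj₂ (i , h) | inj₂ (j , h′) = does (i ≟ j) ∧ adj H h h′

-- Zykov sum (G,A) + H : vertices Fin (n G + n H); inj₁ = G, inj₂ = H.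

inA? : ∀ {N k} (a : Fin k → Fin N) (u : Fin N) → Bool
inA? a u = does (any? λ i → u ≟ a i)

zykov : (G : Graph) {k : ℕ} → (Fin k → Fin (n G)) → Graph → Graph
zykov G {k} a H = mkGraph (n G + n H) ad
  where
  ad : Fin (n G + n H) → Fin (n G + n H) → Bool
  ad x y with splitAt (n G) x | splitAt (n G) y
  ... | inj₁ u | inj₁ v = adj G u v
  ... | inj₁ u | inj₂ h = inA? a u
  ... | inj₂ h | inj₁ v = inA? a v
  ... | inj₂ h | inj₂ h′ = adj H h h′

module Submission where

-- An independent set of either graph splits as xs ⊎ (rest), where xs is its trace on V(G), so
-- both polynomials are sums over xs of  x ^ ∣ xs ∣ · (fibre polynomial over xs).  Both fibres
-- vanish unless xs is independent in G.  In the corona the rest consists of one independent set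
-- of H in each copy, forced to be empty in the copy hanging at a chosen a i; so the fibre is a
-- product over i of factors 1 (a i ∈ xs) or I(H) (a i ∉ xs).  In the Zykov sum the rest is one
-- independent set of H, forced to be empty if xs meets A; its fibre is 1 or I(H).  As A is a
-- clique, xs contains at most one a i, and in both cases the corona fibre is I(H) ^ (k-1) times
-- the Zykov fibre; summing over xs gives the theorem.

open import Defs
open import Data.Bool using (Bool; true; false; _∧_; if_then_else_)
import Data.Bool as Bool
open import Data.Bool.Properties using (∧-identityʳ; ∧-zeroʳ; ¬-not)
open import Data.Nat using (ℕ; zero; suc; _+_; _*_; _∸_; _≤_)
import Data.Nat as ℕ
open import Data.Nat.Properties using (+-identityʳ; *-zeroʳ; *-comm; +-comm; +-assoc; *-distribˡ-+; +-commutativeSemigroup)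
open import Data.Nat.ListAction using (sum)
open import Algebra.Properties.CommutativeSemigroup +-commutativeSemigroup using (interchange)
open import Data.List using (List; []; _∷_; map; applyUpTo; length; filter) renaming (_++_ to _++ₗ_)
open import Data.Vec using ([]; _∷_; lookup; tabulate; _++_)
open import Data.Vec.Properties using (lookup-++ˡ; lookup-++ʳ; lookup∘tabulate; tabulate∘lookup; tabulate-cong; []=⇒lookup; lookup⇒[]=)
open import Data.Fin using (Fin; zero; suc; _≟_; splitAt; join; combine; _↑ˡ_; _↑ʳ_)
open import Data.Fin.Properties using (suc-injective; any?; splitAt⁻¹-↑ˡ; splitAt⁻¹-↑ʳ; splitAt-↑ˡ; splitAt-↑ʳ; splitAt-join; join-splitAt; remQuot-combine; combine-remQuot)
open import Data.Fin.Subset using (Subset; ∣_∣)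
open import Data.Product using (_×_; _,_; proj₁; proj₂; ∃)
open import Data.Sum using (_⊎_; inj₁; inj₂; [_,_]′)
open import Function using (_∘_; id; const)
open import Function.Bundles using (_⇔_; mk⇔)
open import Function.Construct.Composition using (_⇔-∘_)
open import Function.Definitions using (Injective)
open import Relation.Nullary using (Dec; yes; no; does; ¬_; map′; contradiction)
open import Relation.Nullary.Decidable using (_×-dec_; _→-dec_; does-⇔; dec-true; dec-false; decidable-stable)
open import Relation.Unary using (Decidable)
open import Relation.Binary.PropositionalEquality using (_≡_; _≢_; refl; sym; trans; cong; cong₂; subst; subst₂; _→-setoid_; module ≡-Reasoning)
import Relation.Binary.Reasoning.Setoid as SetoidReasoning

infixl 26 _+P_
infixl 27 _⊛_

module ≈P-Reasoning = SetoidReasoning (ℕ →-setoid ℕ)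

≈P-sym : ∀ {p q} → p ≈P q → q ≈P p
≈P-sym e k = sym (e k)

_+P_ : Poly → Poly → Poly
(p +P q) k = p k + q k

0P : Poly
0P _ = 0

+P-cong : ∀ {p p′ q q′} → p ≈P p′ → q ≈P q′ → p +P q ≈P p′ +P q′
+P-cong e f k = cong₂ _+_ (e k) (f k)

shift : Poly → Poly
shift p zero    = 0
shift p (suc k) = p k

shiftBy : ℕ → Poly → Poly
shiftBy zero    p = p
shiftBy (suc d) p = shift (shiftBy d p)

mono : ℕ → Poly
mono d = shiftBy d oneP

tail : Poly → Poly
tail p k = p (suc k)

_⊛_ : Poly → Poly → Poly
(p ⊛ q) zero    = p 0 * q 0
(p ⊛ q) (suc k) = p 0 * q (suc k) + (tail p ⊛ q) k

-- ∑_{i < n} f i, by recursion that matches the recursion of _⊛_.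
sumBelow : ℕ → (ℕ → ℕ) → ℕ
sumBelow zero    f = 0
sumBelow (suc n) f = f 0 + sumBelow n (f ∘ suc)

sum-applyUpTo : ∀ n (f g : ℕ → ℕ) → sum (map f (applyUpTo g n)) ≡ sumBelow n (f ∘ g)
sum-applyUpTo zero    f g = refl
sum-applyUpTo (suc n) f g = cong (f (g 0) +_) (sum-applyUpTo n f (g ∘ suc))

sumBelow-⊛ : ∀ k p q → sumBelow (suc k) (λ i → p i * q (k ∸ i)) ≡ (p ⊛ q) k
sumBelow-⊛ zero    p q = +-identityʳ (p 0 * q 0)
sumBelow-⊛ (suc k) p q = cong (p 0 * q (suc k) +_) (sumBelow-⊛ k (tail p) q)

*P≈⊛ : ∀ p q → (p *P q) ≈P p ⊛ q
*P≈⊛ p q k = trans (sum-applyUpTo (suc k) _ id) (sumBelow-⊛ k p q)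

⊛-congˡ : ∀ {p p′} q → p ≈P p′ → p ⊛ q ≈P p′ ⊛ q
⊛-congˡ q e zero    = cong (_* q 0) (e 0)
⊛-congˡ q e (suc k) = cong₂ _+_ (cong (_* q (suc k)) (e 0)) (⊛-congˡ q (e ∘ suc) k)

⊛-congʳ : ∀ p {q q′} → q ≈P q′ → p ⊛ q ≈P p ⊛ q′
⊛-congʳ p e zero    = cong (p 0 *_) (e 0)
⊛-congʳ p e (suc k) = cong₂ _+_ (cong (p 0 *_) (e (suc k))) (⊛-congʳ (tail p) e k)

*P-cong : ∀ {p p′ q q′} → p ≈P p′ → q ≈P q′ → (p *P q) ≈P (p′ *P q′)
*P-cong {p} {p′} {q} {q′} e f = begin
  p *P q    ≈⟨ *P≈⊛ p q ⟩
  p ⊛ q     ≈⟨ ⊛-congˡ q e ⟩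
  p′ ⊛ q    ≈⟨ ⊛-congʳ p′ f ⟩
  p′ ⊛ q′   ≈⟨ *P≈⊛ p′ q′ ⟨
  p′ *P q′  ∎
  where open ≈P-Reasoning

⊛-zeroˡ : ∀ q → 0P ⊛ q ≈P 0P
⊛-zeroˡ q zero    = refl
⊛-zeroˡ q (suc k) = ⊛-zeroˡ q k

⊛-zeroʳ : ∀ p → p ⊛ 0P ≈P 0P
⊛-zeroʳ p zero    = *-zeroʳ (p 0)
⊛-zeroʳ p (suc k) = cong₂ _+_ (*-zeroʳ (p 0)) (⊛-zeroʳ (tail p) k)

⊛-identityˡ : ∀ q → oneP ⊛ q ≈P q
⊛-identityˡ q zero    = +-identityʳ (q 0)
⊛-identityˡ q (suc k) = trans (cong₂ _+_ (+-identityʳ (q (suc k))) (⊛-zeroˡ q k)) (+-identityʳ (q (suc k)))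

⊛-distribˡ : ∀ p q r → p ⊛ (q +P r) ≈P p ⊛ q +P p ⊛ r
⊛-distribˡ p q r zero    = *-distribˡ-+ (p 0) (q 0) (r 0)
⊛-distribˡ p q r (suc k) =
  trans (cong₂ _+_ (*-distribˡ-+ (p 0) (q (suc k)) (r (suc k))) (⊛-distribˡ (tail p) q r k))
        (interchange (p 0 * q (suc k)) (p 0 * r (suc k)) ((tail p ⊛ q) k) ((tail p ⊛ r) k))

⊛-last : ∀ k p q → (p ⊛ q) (suc k) ≡ (p ⊛ tail q) k + p (suc k) * q 0
⊛-last zero    p q = refl
⊛-last (suc k) p q = trans (cong (p 0 * q (suc (suc k)) +_) (⊛-last k (tail p) q))
                           (sym (+-assoc (p 0 * q (suc (suc k))) _ _))

⊛-comm : ∀ p q → p ⊛ q ≈P q ⊛ p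
⊛-comm p q zero    = *-comm (p 0) (q 0)
⊛-comm p q (suc k) = begin
  p 0 * q (suc k) + (tail p ⊛ q) k  ≡⟨ cong (p 0 * q (suc k) +_) (⊛-comm (tail p) q k) ⟩
  p 0 * q (suc k) + (q ⊛ tail p) k  ≡⟨ +-comm (p 0 * q (suc k)) _ ⟩
  (q ⊛ tail p) k + p 0 * q (suc k)  ≡⟨ cong ((q ⊛ tail p) k +_) (*-comm (p 0) (q (suc k))) ⟩
  (q ⊛ tail p) k + q (suc k) * p 0  ≡⟨ ⊛-last k q p ⟨
  (q ⊛ p) (suc k)                   ∎
  where open ≡-Reasoning

⊛-identityʳ : ∀ p → p ⊛ oneP ≈P p
⊛-identityʳ p k = trans (⊛-comm p oneP k) (⊛-identityˡ p k)

shift-cong : ∀ {p q} → p ≈P q → shift p ≈P shift q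
shift-cong e zero    = refl
shift-cong e (suc k) = e k

shiftBy-cong : ∀ d {p q} → p ≈P q → shiftBy d p ≈P shiftBy d q
shiftBy-cong zero    e = e
shiftBy-cong (suc d) e = shift-cong (shiftBy-cong d e)

shiftBy-+ : ∀ a b p → shiftBy (a + b) p ≡ shiftBy a (shiftBy b p)
shiftBy-+ zero    b p = refl
shiftBy-+ (suc a) b p = cong shift (shiftBy-+ a b p)

shiftBy-0P : ∀ d → shiftBy d 0P ≈P 0P
shiftBy-0P zero    k       = refl
shiftBy-0P (suc d) zero    = refl
shiftBy-0P (suc d) (suc k) = shiftBy-0P d k

shift-⊛ˡ : ∀ p q → shift p ⊛ q ≈P shift (p ⊛ q)
shift-⊛ˡ p q zero    = refl
shift-⊛ˡ p q (suc k) = refl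

shiftBy-⊛ˡ : ∀ d p q → shiftBy d p ⊛ q ≈P shiftBy d (p ⊛ q)
shiftBy-⊛ˡ zero    p q k = refl
shiftBy-⊛ˡ (suc d) p q k = trans (shift-⊛ˡ (shiftBy d p) q k) (shift-cong (shiftBy-⊛ˡ d p q) k)

⊛-shiftʳ : ∀ p q → p ⊛ shift q ≈P shift (p ⊛ q)
⊛-shiftʳ p q zero          = *-zeroʳ (p 0)
⊛-shiftʳ p q (suc zero)    = trans (cong (p 0 * q 0 +_) (*-zeroʳ (p 1))) (+-identityʳ (p 0 * q 0))
⊛-shiftʳ p q (suc (suc k)) = cong (p 0 * q (suc k) +_) (⊛-shiftʳ (tail p) q (suc k))

⊛-shiftByʳ : ∀ d p q → p ⊛ shiftBy d q ≈P shiftBy d (p ⊛ q)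
⊛-shiftByʳ zero    p q k = refl
⊛-shiftByʳ (suc d) p q k = trans (⊛-shiftʳ p (shiftBy d q) k) (shift-cong (⊛-shiftByʳ d p q) k)

∑ : {A : Set} → List A → (A → Poly) → Poly
∑ []      h = 0P
∑ (x ∷ L) h = h x +P ∑ L h

∑-cong : ∀ {A : Set} (L : List A) {h h′ : A → Poly} → (∀ x → h x ≈P h′ x) → ∑ L h ≈P ∑ L h′
∑-cong []      e k = refl
∑-cong (x ∷ L) e k = cong₂ _+_ (e x k) (∑-cong L e k)

∑-++ : ∀ {A : Set} (L M : List A) h → ∑ (L ++ₗ M) h ≈P ∑ L h +P ∑ M h
∑-++ []      M h k = refl
∑-++ (x ∷ L) M h k = trans (cong (h x k +_) (∑-++ L M h k)) (sym (+-assoc (h x k) _ _))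

∑-map : ∀ {A B : Set} (L : List A) (g : A → B) h → ∑ (map g L) h ≈P ∑ L (h ∘ g)
∑-map []      g h k = refl
∑-map (x ∷ L) g h k = cong (h (g x) k +_) (∑-map L g h k)

⊛-∑ʳ : ∀ {A : Set} p (L : List A) h → p ⊛ ∑ L h ≈P ∑ L (λ x → p ⊛ h x)
⊛-∑ʳ p []      h   = ⊛-zeroʳ p
⊛-∑ʳ p (x ∷ L) h k = trans (⊛-distribˡ p (h x) (∑ L h) k) (cong ((p ⊛ h x) k +_) (⊛-∑ʳ p L h k))

∑-⊛ˡ : ∀ {A : Set} (L : List A) h q → ∑ L h ⊛ q ≈P ∑ L (λ x → h x ⊛ q)
∑-⊛ˡ L h q = begin
  ∑ L h ⊛ q            ≈⟨ ⊛-comm (∑ L h) q ⟩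
  q ⊛ ∑ L h            ≈⟨ ⊛-∑ʳ q L h ⟩
  ∑ L (λ x → q ⊛ h x)  ≈⟨ ∑-cong L (λ x → ⊛-comm q (h x)) ⟩
  ∑ L (λ x → h x ⊛ q)  ∎
  where open ≈P-Reasoning

shift-∑ : ∀ {A : Set} (L : List A) h → shift (∑ L h) ≈P ∑ L (shift ∘ h)
shift-∑ []      h zero    = refl
shift-∑ []      h (suc k) = refl
shift-∑ (x ∷ L) h zero    = shift-∑ L h zero
shift-∑ (x ∷ L) h (suc k) = cong (h x k +_) (shift-∑ L h (suc k))

shiftBy-∑ : ∀ {A : Set} d (L : List A) h → shiftBy d (∑ L h) ≈P ∑ L (shiftBy d ∘ h)
shiftBy-∑ zero    L h k = refl
shiftBy-∑ (suc d) L h k = trans (shift-cong (shiftBy-∑ d L h) k) (shift-∑ L (shiftBy d ∘ h) k)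

guard : Bool → Poly → Poly
guard true  p = p
guard false p = 0P

guard-cong : ∀ b {p q} → p ≈P q → guard b p ≈P guard b q
guard-cong true  e   = e
guard-cong false e k = refl

guard-shiftBy : ∀ b d p → guard b (shiftBy d p) ≈P shiftBy d (guard b p)
guard-shiftBy true  d p k = refl
guard-shiftBy false d p k = sym (shiftBy-0P d k)

count : ∀ {m} → List (Subset m) → (Subset m → Bool) → Poly
count L f = ∑ L (λ S → guard (f S) (mono ∣ S ∣))

mono-coeff : ∀ d k → mono d k ≡ (if does (d ℕ.≟ k) then 1 else 0)
mono-coeff zero    zero    = refl
mono-coeff zero    (suc k) = refl
mono-coeff (suc d) zero    = refl
mono-coeff (suc d) (suc k) = mono-coeff d k

-- The coefficients of b · x ^ d, in the shape produced by filtering with (∣ S ∣ ≟ k) ×-dec _.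
guard-mono-coeff : ∀ b d k → guard b (mono d) k ≡ (if does (d ℕ.≟ k) ∧ b then 1 else 0)
guard-mono-coeff true  d k rewrite ∧-identityʳ (does (d ℕ.≟ k)) = mono-coeff d k
guard-mono-coeff false d k rewrite ∧-zeroʳ (does (d ℕ.≟ k))     = refl

length-filter-∷ : ∀ {A : Set} {P : A → Set} (P? : Decidable P) x L →
  length (filter P? (x ∷ L)) ≡ (if does (P? x) then 1 else 0) + length (filter P? L)
length-filter-∷ P? x L with does (P? x)
... | true  = refl
... | false = refl

length-filter : ∀ {m} {P : Subset m → Set} (P? : Decidable P) L k →
  length (filter (λ S → (∣ S ∣ ℕ.≟ k) ×-dec P? S) L) ≡ count L (does ∘ P?) k
length-filter P? []      k = refl
length-filter P? (S ∷ L) k =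
  trans (length-filter-∷ (λ S → (∣ S ∣ ℕ.≟ k) ×-dec P? S) S L)
        (cong₂ _+_ (sym (guard-mono-coeff (does (P? S)) ∣ S ∣ k)) (length-filter P? L k))

indPoly-count : ∀ X → indPoly X ≈P count (allSubsets (n X)) (does ∘ independent? X)
indPoly-count X = length-filter (independent? X) (allSubsets (n X))

∑-allSubsets-++ : ∀ N M (h : Subset (N + M) → Poly) →
  ∑ (allSubsets (N + M)) h ≈P ∑ (allSubsets N) (λ xs → ∑ (allSubsets M) (λ ys → h (xs ++ ys)))
∑-allSubsets-++ zero    M h k = sym (+-identityʳ _)
∑-allSubsets-++ (suc N) M h = begin
  ∑ (map (false ∷_) A ++ₗ map (true ∷_) A) h
    ≈⟨ ∑-++ (map (false ∷_) A) _ h ⟩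
  ∑ (map (false ∷_) A) h +P ∑ (map (true ∷_) A) h
    ≈⟨ +P-cong (∑-map A _ h) (∑-map A _ h) ⟩
  ∑ A (h ∘ (false ∷_)) +P ∑ A (h ∘ (true ∷_))
    ≈⟨ +P-cong (∑-allSubsets-++ N M _) (∑-allSubsets-++ N M _) ⟩
  ∑ B (inner ∘ (false ∷_)) +P ∑ B (inner ∘ (true ∷_))
    ≈⟨ +P-cong (∑-map B _ inner) (∑-map B _ inner) ⟨
  ∑ (map (false ∷_) B) inner +P ∑ (map (true ∷_) B) inner
    ≈⟨ ∑-++ (map (false ∷_) B) _ inner ⟨
  ∑ (map (false ∷_) B ++ₗ map (true ∷_) B) inner ∎
  where
  open ≈P-Reasoning
  A : List (Subset (N + M))
  A = allSubsets (N + M)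
  B : List (Subset N)
  B = allSubsets N
  inner : Subset (suc N) → Poly
  inner xs = ∑ (allSubsets M) (λ ys → h (xs ++ ys))

∣++∣ : ∀ {N M} (xs : Subset N) (ys : Subset M) → ∣ xs ++ ys ∣ ≡ ∣ xs ∣ + ∣ ys ∣
∣++∣ []           ys = refl
∣++∣ (true  ∷ xs) ys = cong suc (∣++∣ xs ys)
∣++∣ (false ∷ xs) ys = ∣++∣ xs ys

count-split : ∀ N M (f : Subset (N + M) → Bool) →
  count (allSubsets (N + M)) f ≈P
  ∑ (allSubsets N) (λ xs → shiftBy ∣ xs ∣ (count (allSubsets M) (λ ys → f (xs ++ ys))))
count-split N M f = begin
  count (allSubsets (N + M)) f
    ≈⟨ ∑-allSubsets-++ N M _ ⟩
  ∑ (allSubsets N) (λ xs → ∑ (allSubsets M) (λ ys → guard (f (xs ++ ys)) (mono ∣ xs ++ ys ∣)))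
    ≈⟨ ∑-cong (allSubsets N) (λ xs → ∑-cong (allSubsets M) (term xs)) ⟩
  ∑ (allSubsets N) (λ xs → ∑ (allSubsets M) (λ ys → shiftBy ∣ xs ∣ (guard (f (xs ++ ys)) (mono ∣ ys ∣))))
    ≈⟨ ∑-cong (allSubsets N) (λ xs → ≈P-sym (shiftBy-∑ ∣ xs ∣ (allSubsets M) _)) ⟩
  ∑ (allSubsets N) (λ xs → shiftBy ∣ xs ∣ (count (allSubsets M) (λ ys → f (xs ++ ys)))) ∎
  where
  open ≈P-Reasoning
  term : ∀ xs ys → guard (f (xs ++ ys)) (mono ∣ xs ++ ys ∣) ≈P shiftBy ∣ xs ∣ (guard (f (xs ++ ys)) (mono ∣ ys ∣))
  term xs ys k =
    trans (cong (λ d → guard (f (xs ++ ys)) (shiftBy d oneP) k) (∣++∣ xs ys))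
          (trans (cong (λ p → guard (f (xs ++ ys)) p k) (shiftBy-+ ∣ xs ∣ ∣ ys ∣ oneP))
                 (guard-shiftBy (f (xs ++ ys)) ∣ xs ∣ (mono ∣ ys ∣) k))

count-cong : ∀ {m} (L : List (Subset m)) {f g : Subset m → Bool} → (∀ S → f S ≡ g S) → count L f ≈P count L g
count-cong L e = ∑-cong L (λ S k → cong (λ b → guard b (mono ∣ S ∣) k) (e S))

count-none : ∀ {m} (L : List (Subset m)) → count L (λ _ → false) ≈P 0P
count-none []      k = refl
count-none (S ∷ L) k = count-none L k

count-∧ : ∀ {m} (L : List (Subset m)) b (g : Subset m → Bool) → count L (λ S → b ∧ g S) ≈P guard b (count L g)
count-∧ L true  g k = refl
count-∧ L false g   = count-none L

true≢false : true ≢ false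
true≢false ()

Empty : ∀ {m} → Subset m → Set
Empty t = ∀ h → lookup t h ≡ false

empty? : ∀ {m} (t : Subset m) → Dec (Empty t)
empty? []          = yes (λ ())
empty? (true  ∷ t) = no (λ e → true≢false (e zero))
empty? (false ∷ t) = map′ (λ { e zero → refl ; e (suc h) → e h }) (_∘ suc) (empty? t)

count-∅ : ∀ m → count (allSubsets m) (does ∘ empty?) ≈P oneP
count-∅ zero    k = +-identityʳ (oneP k)
count-∅ (suc m) = begin
  count (map (false ∷_) A ++ₗ map (true ∷_) A) (does ∘ empty?)
    ≈⟨ ∑-++ (map (false ∷_) A) _ _ ⟩
  count (map (false ∷_) A) (does ∘ empty?) +P count (map (true ∷_) A) (does ∘ empty?)
    ≈⟨ +P-cong (∑-map A _ _) (∑-map A _ _) ⟩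
  count A (does ∘ empty?) +P count A (λ _ → false)
    ≈⟨ +P-cong (count-∅ m) (count-none A) ⟩
  oneP +P 0P
    ≈⟨ +-identityʳ ∘ oneP ⟩
  oneP ∎
  where
  open ≈P-Reasoning
  A : List (Subset m)
  A = allSubsets m

mono-⊛ : ∀ d q → mono d ⊛ q ≈P shiftBy d q
mono-⊛ d q k = trans (shiftBy-⊛ˡ d oneP q k) (shiftBy-cong d (⊛-identityˡ q) k)

count-product : ∀ N M (F : Subset (N + M) → Bool) (f : Subset N → Bool) (g : Subset M → Bool) →
  (∀ xs ys → F (xs ++ ys) ≡ f xs ∧ g ys) →
  count (allSubsets (N + M)) F ≈P count (allSubsets N) f ⊛ count (allSubsets M) g
count-product N M F f g split = begin
  count (allSubsets (N + M)) F
    ≈⟨ count-split N M F ⟩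
  ∑ (allSubsets N) (λ xs → shiftBy ∣ xs ∣ (count (allSubsets M) (λ ys → F (xs ++ ys))))
    ≈⟨ ∑-cong (allSubsets N) (λ xs → shiftBy-cong ∣ xs ∣ (factor xs)) ⟩
  ∑ (allSubsets N) (λ xs → shiftBy ∣ xs ∣ (guard (f xs) Cg))
    ≈⟨ ∑-cong (allSubsets N) (λ xs → term (f xs) ∣ xs ∣) ⟩
  ∑ (allSubsets N) (λ xs → guard (f xs) (mono ∣ xs ∣) ⊛ Cg)
    ≈⟨ ∑-⊛ˡ (allSubsets N) _ Cg ⟨
  count (allSubsets N) f ⊛ Cg ∎
  where
  open ≈P-Reasoning
  Cg : Poly
  Cg = count (allSubsets M) g
  factor : ∀ xs → count (allSubsets M) (λ ys → F (xs ++ ys)) ≈P guard (f xs) Cg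
  factor xs k = trans (count-cong (allSubsets M) (split xs) k) (count-∧ (allSubsets M) (f xs) g k)
  term : ∀ b d → shiftBy d (guard b Cg) ≈P guard b (mono d) ⊛ Cg
  term true  d k = sym (mono-⊛ d Cg k)
  term false d k = trans (shiftBy-0P d k) (sym (⊛-zeroˡ Cg k))

block : ∀ {K m} → Fin K → Subset (K * m) → Subset m
block i T = tabulate (λ h → lookup T (combine i h))

block-head : ∀ {K m} (t : Subset m) (T : Subset (K * m)) → block {suc K} zero (t ++ T) ≡ t
block-head t T = trans (tabulate-cong (lookup-++ˡ t T)) (tabulate∘lookup t)

block-tail : ∀ {K m} (i : Fin K) (t : Subset m) (T : Subset (K * m)) → block (suc i) (t ++ T) ≡ block i T
block-tail i t T = tabulate-cong (λ h → lookup-++ʳ t T (combine i h))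

allᶠ : ∀ {K} → (Fin K → Bool) → Bool
allᶠ {zero}  f = true
allᶠ {suc K} f = f zero ∧ allᶠ (f ∘ suc)

allᶠ-cong : ∀ {K} {f g : Fin K → Bool} → (∀ i → f i ≡ g i) → allᶠ f ≡ allᶠ g
allᶠ-cong {zero}  e = refl
allᶠ-cong {suc K} e = cong₂ _∧_ (e zero) (allᶠ-cong (e ∘ suc))

allᶠ? : ∀ {K} {P : Fin K → Set} → (∀ i → Dec (P i)) → Dec (∀ i → P i)
allᶠ? {zero}  P? = yes (λ ())
allᶠ? {suc K} P? =
  map′ (λ (p , ps) → λ { zero → p ; (suc i) → ps i }) (λ ps → ps zero , ps ∘ suc) (P? zero ×-dec allᶠ? (P? ∘ suc))

does-allᶠ? : ∀ {K} {P : Fin K → Set} (P? : ∀ i → Dec (P i)) → does (allᶠ? P?) ≡ allᶠ (does ∘ P?)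
does-allᶠ? {zero}  P? = refl
does-allᶠ? {suc K} P? = cong (does (P? zero) ∧_) (does-allᶠ? (P? ∘ suc))

∏ : ∀ K → (Fin K → Poly) → Poly
∏ zero    c = oneP
∏ (suc K) c = c zero *P ∏ K (c ∘ suc)

block-count : ∀ K m (Q : Fin K → Subset m → Bool) →
  count (allSubsets (K * m)) (λ T → allᶠ (λ i → Q i (block i T))) ≈P ∏ K (λ i → count (allSubsets m) (Q i))
block-count zero    m Q k = +-identityʳ (oneP k)
block-count (suc K) m Q = begin
  count (allSubsets (suc K * m)) (allBlocks Q)
    ≈⟨ count-product m (K * m) (allBlocks Q) (Q zero) (allBlocks (Q ∘ suc)) split ⟩
  count (allSubsets m) (Q zero) ⊛ count (allSubsets (K * m)) (allBlocks (Q ∘ suc))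
    ≈⟨ ⊛-congʳ _ (block-count K m (Q ∘ suc)) ⟩
  count (allSubsets m) (Q zero) ⊛ ∏ K (λ i → count (allSubsets m) (Q (suc i)))
    ≈⟨ *P≈⊛ _ _ ⟨
  ∏ (suc K) (λ i → count (allSubsets m) (Q i)) ∎
  where
  open ≈P-Reasoning
  allBlocks : ∀ {K′} → (Fin K′ → Subset m → Bool) → Subset (K′ * m) → Bool
  allBlocks R T = allᶠ (λ i → R i (block i T))
  split : ∀ t T → allBlocks Q (t ++ T) ≡ Q zero t ∧ allBlocks (Q ∘ suc) T
  split t T = cong₂ _∧_ (cong (Q zero) (block-head {K} t T)) (allᶠ-cong (λ i → cong (Q (suc i)) (block-tail {K} i t T)))

∏-cong : ∀ K {c d : Fin K → Poly} → (∀ i → c i ≈P d i) → ∏ K c ≈P ∏ K d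
∏-cong zero    e k = refl
∏-cong (suc K) e   = *P-cong (e zero) (∏-cong K (e ∘ suc))

∏-const : ∀ K p → ∏ K (λ _ → p) ≈P (p ^P K)
∏-const zero    p k = refl
∏-const (suc K) p   = *P-cong {p} (λ _ → refl) (∏-const K p)

∏-oneHot : ∀ K (c : Fin K → Poly) p (j : Fin K) → c j ≈P oneP → (∀ i → i ≢ j → c i ≈P p) →
  ∏ K c ≈P (p ^P (K ∸ 1))
∏-oneHot (suc K) c p zero cj≈1 others = begin
  (c zero *P ∏ K (c ∘ suc))  ≈⟨ *P≈⊛ _ _ ⟩
  c zero ⊛ ∏ K (c ∘ suc)     ≈⟨ ⊛-congˡ _ cj≈1 ⟩
  oneP ⊛ ∏ K (c ∘ suc)       ≈⟨ ⊛-identityˡ _ ⟩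
  ∏ K (c ∘ suc)              ≈⟨ ∏-cong K (λ i → others (suc i) (λ ())) ⟩
  ∏ K (λ _ → p)              ≈⟨ ∏-const K p ⟩
  (p ^P K) ∎
  where open ≈P-Reasoning
∏-oneHot (suc (suc K)) c p (suc j) cj≈1 others =
  *P-cong (others zero (λ ())) (∏-oneHot (suc K) (c ∘ suc) p j cj≈1 (λ i i≢j → others (suc i) (i≢j ∘ suc-injective)))

IndependentIn : {V : Set} → (V → V → Bool) → (V → Bool) → Set
IndependentIn E S = ∀ u v → S u ≡ true → S v ≡ true → E u v ≡ false

adjacent-excluded : ∀ {V : Set} {E : V → V → Bool} {S : V → Bool} {u v} →
  IndependentIn E S → E u v ≡ true → S u ≡ true → S v ≡ false
adjacent-excluded i e su = ¬-not (λ sv → true≢false (trans (sym e) (i _ _ su sv)))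

indep? : (X : Graph) (S : Subset (n X)) → Dec (IndependentIn (adj X) (lookup S))
indep? X S = map′ (λ i u v p q → i u v (lookup⇒[]= u S p) (lookup⇒[]= v S q))
                  (λ i u v p q → i u v ([]=⇒lookup p) ([]=⇒lookup q))
                  (independent? X S)

empty-independent : (X : Graph) {t : Subset (n X)} → Empty t → IndependentIn (adj X) (lookup t)
empty-independent X e u v p _ = contradiction (trans (sym p) (e u)) true≢false

record GraphView (X : Graph) (V : Set) : Set where
  field
    view        : Fin (n X) → V
    vertex      : V → Fin (n X)
    view-vertex : ∀ w → view (vertex w) ≡ w
    vertex-view : ∀ x → vertex (view x) ≡ x
    adjᵛ        : V → V → Bool
    adj-view    : ∀ x y → adj X x y ≡ adjᵛ (view x) (view y)

  independent-view : (S : Subset (n X)) (mem : V → Bool) → (∀ w → lookup S (vertex w) ≡ mem w) →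
    IndependentIn (adj X) (lookup S) ⇔ IndependentIn adjᵛ mem
  independent-view S mem mem-vertex = mk⇔ to from
    where
    to : IndependentIn (adj X) (lookup S) → IndependentIn adjᵛ mem
    to i w w′ p q =
      subst₂ (λ z z′ → adjᵛ z z′ ≡ false) (view-vertex w) (view-vertex w′)
        (trans (sym (adj-view (vertex w) (vertex w′)))
               (i (vertex w) (vertex w′) (trans (mem-vertex w) p) (trans (mem-vertex w′) q)))
    mem-view : ∀ x → lookup S x ≡ true → mem (view x) ≡ true
    mem-view x p = trans (sym (mem-vertex (view x))) (trans (cong (lookup S) (vertex-view x)) p)
    from : IndependentIn adjᵛ mem → IndependentIn (adj X) (lookup S)
    from i x y p q = trans (adj-view x y) (i (view x) (view y) (mem-view x p) (mem-view y q))

-- The admissible traces t of an independent set on a copy of H attached to some vertex, where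
-- B says that this vertex is selected: t is independent in H, and empty if B holds.
BlockOK : (H : Graph) → Set → Subset (n H) → Set
BlockOK H B t = IndependentIn (adj H) (lookup t) × (B → Empty t)

blockOK? : ∀ H {B} → Dec B → (t : Subset (n H)) → Dec (BlockOK H B t)
blockOK? H B? t = indep? H t ×-dec (B? →-dec empty? t)

count-blockOK-chosen : ∀ H {B} (B? : Dec B) → B → count (allSubsets (n H)) (does ∘ blockOK? H B?) ≈P oneP
count-blockOK-chosen H (yes b) _ k =
  trans (count-cong (allSubsets (n H)) (λ t → does-⇔ (only-empty t) (blockOK? H (yes b) t) (empty? t)) k)
        (count-∅ (n H) k)
  where
  only-empty : ∀ t → BlockOK H _ t ⇔ Empty t
  only-empty t = mk⇔ (λ ok → proj₂ ok b) (λ e → empty-independent H {t} e , const e)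
count-blockOK-chosen H (no ¬b) b = contradiction b ¬b

count-blockOK-free : ∀ H {B} (B? : Dec B) → ¬ B → count (allSubsets (n H)) (does ∘ blockOK? H B?) ≈P indPoly H
count-blockOK-free H (yes b) ¬b = contradiction b ¬b
count-blockOK-free H (no _)  _  k =
  trans (count-cong (allSubsets (n H)) (λ t → ∧-identityʳ (does (indep? H t))) k) (sym (indPoly-count H k))

module Corona (G H : Graph) {K : ℕ} (a : Fin K → Fin (n G)) where

  private
    N m : ℕ
    N = n G
    m = n H

  V : Set
  V = Fin N ⊎ (Fin K × Fin m)

  adjᶜ : V → V → Bool
  adjᶜ (inj₁ u)       (inj₁ v)        = adj G u v
  adjᶜ (inj₁ u)       (inj₂ (j , h))  = does (u ≟ a j)
  adjᶜ (inj₂ (i , h)) (inj₁ v)        = does (v ≟ a i)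
  adjᶜ (inj₂ (i , h)) (inj₂ (j , h′)) = does (i ≟ j) ∧ adj H h h′

  vertexᶜ : V → Fin (N + K * m)
  vertexᶜ (inj₁ u)       = u ↑ˡ (K * m)
  vertexᶜ (inj₂ (i , h)) = N ↑ʳ combine i h

  corona-view : GraphView (corona G a H) V
  corona-view = record
    { view = coronaView ; vertex = vertexᶜ ; view-vertex = view-vertex ; vertex-view = vertex-view
    ; adjᵛ = adjᶜ ; adj-view = adj-view }
    where
    view-vertex : ∀ w → coronaView (vertexᶜ w) ≡ w
    view-vertex (inj₁ u) rewrite splitAt-↑ˡ N u (K * m) = refl
    view-vertex (inj₂ (i , h)) rewrite splitAt-↑ʳ N (K * m) (combine i h) | remQuot-combine {K} {m} i h = refl
    vertex-view : ∀ x → vertexᶜ (coronaView x) ≡ x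
    vertex-view x with splitAt N x in e
    ... | inj₁ u = splitAt⁻¹-↑ˡ e
    ... | inj₂ y = trans (cong (N ↑ʳ_) (combine-remQuot {K} m y)) (splitAt⁻¹-↑ʳ e)
    adj-view : ∀ x y → adj (corona G a H) x y ≡ adjᶜ (coronaView x) (coronaView y)
    adj-view x y with coronaView {N} {K} {m} x | coronaView {N} {K} {m} y
    ... | inj₁ u       | inj₁ v        = refl
    ... | inj₁ u       | inj₂ (j , h)  = refl
    ... | inj₂ (i , h) | inj₁ v        = refl
    ... | inj₂ (i , h) | inj₂ (j , h′) = refl

  members : Subset N → Subset (K * m) → V → Bool
  members xs T (inj₁ u)       = lookup xs u
  members xs T (inj₂ (i , h)) = lookup (block i T) h

  members-vertex : ∀ xs T w → lookup (xs ++ T) (vertexᶜ w) ≡ members xs T w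
  members-vertex xs T (inj₁ u)       = lookup-++ˡ xs T u
  members-vertex xs T (inj₂ (i , h)) = trans (lookup-++ʳ xs T (combine i h)) (sym (lookup∘tabulate _ h))

  chosen? : (xs : Subset N) (i : Fin K) → Dec (lookup xs (a i) ≡ true)
  chosen? xs i = lookup xs (a i) Bool.≟ true

  corona-independent : ∀ xs T → IndependentIn adjᶜ (members xs T) ⇔
    (IndependentIn (adj G) (lookup xs) × (∀ i → BlockOK H (lookup xs (a i) ≡ true) (block i T)))
  corona-independent xs T = mk⇔ to from
    where
    to : IndependentIn adjᶜ (members xs T) →
         IndependentIn (adj G) (lookup xs) × (∀ i → BlockOK H (lookup xs (a i) ≡ true) (block i T))
    to ind = (λ u v → ind (inj₁ u) (inj₁ v)) , λ j → block-independent j , block-empty j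
      where
      block-independent : ∀ j → IndependentIn (adj H) (lookup (block j T))
      block-independent j h h′ p q =
        subst (λ b → b ∧ adj H h h′ ≡ false) (dec-true (j ≟ j) refl) (ind (inj₂ (j , h)) (inj₂ (j , h′)) p q)
      block-empty : ∀ j → lookup xs (a j) ≡ true → Empty (block j T)
      block-empty j xa h = adjacent-excluded {u = inj₁ (a j)} {v = inj₂ (j , h)} ind (dec-true (a j ≟ a j) refl) xa
    from : IndependentIn (adj G) (lookup xs) × (∀ i → BlockOK H (lookup xs (a i) ≡ true) (block i T)) →
           IndependentIn adjᶜ (members xs T)
    from (g , ok) (inj₁ u) (inj₁ v) p q = g u v p q
    from (g , ok) (inj₁ u) (inj₂ (j , h)) p q =
      dec-false (u ≟ a j) (λ u≡aj → true≢false (trans (sym q) (proj₂ (ok j) (subst (λ x → lookup xs x ≡ true) u≡aj p) h)))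
    from (g , ok) (inj₂ (i , h)) (inj₁ v) p q =
      dec-false (v ≟ a i) (λ v≡ai → true≢false (trans (sym p) (proj₂ (ok i) (subst (λ x → lookup xs x ≡ true) v≡ai q) h)))
    from (g , ok) (inj₂ (i , h)) (inj₂ (j , h′)) p q with i ≟ j
    ... | yes refl = proj₁ (ok i) h h′ p q
    ... | no  _    = refl

  corona-indB : ∀ xs T → does (independent? (corona G a H) (xs ++ T)) ≡
    does (indep? G xs) ∧ allᶠ (λ i → does (blockOK? H (chosen? xs i) (block i T)))
  corona-indB xs T =
    trans (does-⇔ (corona-independent xs T ⇔-∘ GraphView.independent-view corona-view (xs ++ T) (members xs T) (members-vertex xs T))
                  (indep? (corona G a H) (xs ++ T))
                  (indep? G xs ×-dec allᶠ? (λ i → blockOK? H (chosen? xs i) (block i T))))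
          (cong (does (indep? G xs) ∧_) (does-allᶠ? (λ i → blockOK? H (chosen? xs i) (block i T))))

module Zykov (G H : Graph) {K : ℕ} (a : Fin K → Fin (n G)) where

  private
    N m : ℕ
    N = n G
    m = n H

  V : Set
  V = Fin N ⊎ Fin m

  adjᶻ : V → V → Bool
  adjᶻ (inj₁ u) (inj₁ v)  = adj G u v
  adjᶻ (inj₁ u) (inj₂ h)  = inA? a u
  adjᶻ (inj₂ h) (inj₁ v)  = inA? a v
  adjᶻ (inj₂ h) (inj₂ h′) = adj H h h′

  zykov-view : GraphView (zykov G a H) V
  zykov-view = record
    { view = splitAt N ; vertex = join N m ; view-vertex = splitAt-join N m ; vertex-view = join-splitAt N m
    ; adjᵛ = adjᶻ ; adj-view = adj-view }
    where
    adj-view : ∀ x y → adj (zykov G a H) x y ≡ adjᶻ (splitAt N x) (splitAt N y)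
    adj-view x y with splitAt N x | splitAt N y
    ... | inj₁ u | inj₁ v  = refl
    ... | inj₁ u | inj₂ h  = refl
    ... | inj₂ h | inj₁ v  = refl
    ... | inj₂ h | inj₂ h′ = refl

  members : Subset N → Subset m → V → Bool
  members xs ys = [ lookup xs , lookup ys ]′

  members-vertex : ∀ xs ys w → lookup (xs ++ ys) (join N m w) ≡ members xs ys w
  members-vertex xs ys (inj₁ u) = lookup-++ˡ xs ys u
  members-vertex xs ys (inj₂ h) = lookup-++ʳ xs ys h

  meets? : (xs : Subset N) → Dec (∃ λ j → lookup xs (a j) ≡ true)
  meets? xs = any? (λ j → lookup xs (a j) Bool.≟ true)

  zykov-independent : ∀ xs ys → IndependentIn adjᶻ (members xs ys) ⇔
    (IndependentIn (adj G) (lookup xs) × BlockOK H (∃ λ j → lookup xs (a j) ≡ true) ys)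
  zykov-independent xs ys = mk⇔ to from
    where
    to : IndependentIn adjᶻ (members xs ys) →
         IndependentIn (adj G) (lookup xs) × BlockOK H (∃ λ j → lookup xs (a j) ≡ true) ys
    to ind = (λ u v → ind (inj₁ u) (inj₁ v)) , (λ h h′ → ind (inj₂ h) (inj₂ h′)) ,
             λ (j , xa) h → adjacent-excluded {u = inj₁ (a j)} {v = inj₂ h} ind (dec-true (any? _) (j , refl)) xa
    from : IndependentIn (adj G) (lookup xs) × BlockOK H (∃ λ j → lookup xs (a j) ≡ true) ys →
           IndependentIn adjᶻ (members xs ys)
    from (g , indH , empty) (inj₁ u) (inj₁ v)  p q = g u v p q
    from (g , indH , empty) (inj₁ u) (inj₂ h)  p q =
      dec-false (any? _) (λ (j , u≡aj) → true≢false (trans (sym q) (empty (j , subst (λ x → lookup xs x ≡ true) u≡aj p) h)))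
    from (g , indH , empty) (inj₂ h) (inj₁ v)  p q =
      dec-false (any? _) (λ (j , v≡aj) → true≢false (trans (sym p) (empty (j , subst (λ x → lookup xs x ≡ true) v≡aj q) h)))
    from (g , indH , empty) (inj₂ h) (inj₂ h′) p q = indH h h′ p q

  zykov-indB : ∀ xs ys → does (independent? (zykov G a H) (xs ++ ys)) ≡
    does (indep? G xs) ∧ does (blockOK? H (meets? xs) ys)
  zykov-indB xs ys =
    does-⇔ (zykov-independent xs ys ⇔-∘ GraphView.independent-view zykov-view (xs ++ ys) (members xs ys) (members-vertex xs ys))
           (indep? (zykov G a H) (xs ++ ys))
           (indep? G xs ×-dec blockOK? H (meets? xs) ys)

guarded : ∀ {A : Set} (A? : Dec A) {p q r} → (A → p ≈P r ⊛ q) → guard (does A?) p ≈P r ⊛ guard (does A?) q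
guarded (yes x)         e   = e x
guarded (no _)  {r = r} e k = sym (⊛-zeroʳ r k)

clique-meets-once : ∀ {G : Graph} {K} {a : Fin K → Fin (n G)} → IsClique G a →
  ∀ {xs} → IndependentIn (adj G) (lookup xs) → ∀ i j → lookup xs (a i) ≡ true → lookup xs (a j) ≡ true → i ≡ j
clique-meets-once clique ind i j xi xj =
  decidable-stable (i ≟ j) (λ i≢j → true≢false (trans (sym xj) (adjacent-excluded ind (clique i j i≢j) xi)))

module Fibres (G H : Graph) {k : ℕ} (a : Fin (suc k) → Fin (n G)) (clique : IsClique G a) where

  open Corona G H a using (chosen?; corona-indB)
  open Zykov G H a using (meets?; zykov-indB)

  -- The factor I(H) ^ (∣ A ∣ - 1) of the theorem; here ∣ A ∣ = suc k.
  P : Poly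
  P = indPoly H ^P k

  fibreᶜ : Subset (n G) → Poly
  fibreᶜ xs = count (allSubsets (suc k * n H)) (λ T → does (independent? (corona G a H) (xs ++ T)))

  fibreᶻ : Subset (n G) → Poly
  fibreᶻ xs = count (allSubsets (n H)) (λ ys → does (independent? (zykov G a H) (xs ++ ys)))

  -- For xs independent in G, block i contributes 1 if a i ∈ xs and I(H) otherwise; since at most
  -- one a i lies in xs, the product is I(H) ^ k times the contribution 1 or I(H) of the Zykov sum.
  blocks≈ : ∀ xs → IndependentIn (adj G) (lookup xs) →
    ∏ (suc k) (λ i → count (allSubsets (n H)) (does ∘ blockOK? H (chosen? xs i))) ≈P
    P ⊛ count (allSubsets (n H)) (does ∘ blockOK? H (meets? xs))
  blocks≈ xs ind = by-cases (meets? xs)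
    where
    open ≈P-Reasoning
    c : Fin (suc k) → Poly
    c i = count (allSubsets (n H)) (does ∘ blockOK? H (chosen? xs i))
    by-cases : Dec (∃ λ j → lookup xs (a j) ≡ true) → ∏ (suc k) c ≈P P ⊛ count (allSubsets (n H)) (does ∘ blockOK? H (meets? xs))
    by-cases (yes (j , xj)) = begin
      ∏ (suc k) c
        ≈⟨ ∏-oneHot (suc k) c (indPoly H) j (count-blockOK-chosen H (chosen? xs j) xj)
             (λ i i≢j → count-blockOK-free H (chosen? xs i) (λ xi → i≢j (clique-meets-once clique {xs} ind i j xi xj))) ⟩
      P                                                             ≈⟨ ⊛-identityʳ P ⟨
      P ⊛ oneP                                                      ≈⟨ ⊛-congʳ P (count-blockOK-chosen H (meets? xs) (j , xj)) ⟨
      P ⊛ count (allSubsets (n H)) (does ∘ blockOK? H (meets? xs))  ∎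
    by-cases (no none) = begin
      ∏ (suc k) c                   ≈⟨ ∏-cong (suc k) (λ i → count-blockOK-free H (chosen? xs i) (λ xi → none (i , xi))) ⟩
      ∏ (suc k) (λ _ → indPoly H)   ≈⟨ ∏-const (suc k) (indPoly H) ⟩
      (indPoly H *P P)              ≈⟨ *P≈⊛ (indPoly H) P ⟩
      indPoly H ⊛ P                 ≈⟨ ⊛-comm (indPoly H) P ⟩
      P ⊛ indPoly H                 ≈⟨ ⊛-congʳ P (count-blockOK-free H (meets? xs) none) ⟨
      P ⊛ count (allSubsets (n H)) (does ∘ blockOK? H (meets? xs)) ∎

  -- Both fibres vanish unless xs is independent in G; then they are compared by blocks≈.
  fibres : ∀ xs → fibreᶜ xs ≈P P ⊛ fibreᶻ xs
  fibres xs = begin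
    fibreᶜ xs
      ≈⟨ count-cong (allSubsets (suc k * n H)) (corona-indB xs) ⟩
    count (allSubsets (suc k * n H)) (λ T → indG ∧ allᶠ (λ i → does (blockOK? H (chosen? xs i) (block i T))))
      ≈⟨ count-∧ (allSubsets (suc k * n H)) indG _ ⟩
    guard indG (count (allSubsets (suc k * n H)) (λ T → allᶠ (λ i → does (blockOK? H (chosen? xs i) (block i T)))))
      ≈⟨ guard-cong indG (block-count (suc k) (n H) (λ i → does ∘ blockOK? H (chosen? xs i))) ⟩
    guard indG (∏ (suc k) (λ i → count (allSubsets (n H)) (does ∘ blockOK? H (chosen? xs i))))
      ≈⟨ guarded (indep? G xs) (blocks≈ xs) ⟩
    P ⊛ guard indG (count (allSubsets (n H)) (does ∘ blockOK? H (meets? xs)))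
      ≈⟨ ⊛-congʳ P (count-∧ (allSubsets (n H)) indG _) ⟨
    P ⊛ count (allSubsets (n H)) (λ ys → indG ∧ does (blockOK? H (meets? xs) ys))
      ≈⟨ ⊛-congʳ P (count-cong (allSubsets (n H)) (zykov-indB xs)) ⟨
    P ⊛ fibreᶻ xs ∎
    where
    open ≈P-Reasoning
    indG : Bool
    indG = does (indep? G xs)

-- Sum the fibre relation over all traces xs and factor P out of the sum.
lemma2 : (G H : Graph) → IsSimple G → IsSimple H →
         (k : ℕ) → 1 ≤ k → (a : Fin k → Fin (n G)) → Injective _≡_ _≡_ a → IsClique G a →
         indPoly (corona G a H) ≈P ((indPoly H ^P (k ∸ 1)) *P indPoly (zykov G a H))
lemma2 G H _ _ zero    () a _ _
lemma2 G H _ _ (suc k) _  a _ clique = begin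
  indPoly (corona G a H)
    ≈⟨ indPoly-count (corona G a H) ⟩
  count (allSubsets (n G + suc k * n H)) (does ∘ independent? (corona G a H))
    ≈⟨ count-split (n G) (suc k * n H) (does ∘ independent? (corona G a H)) ⟩
  ∑ (allSubsets (n G)) (λ xs → shiftBy ∣ xs ∣ (fibreᶜ xs))
    ≈⟨ ∑-cong (allSubsets (n G)) (λ xs → shiftBy-cong ∣ xs ∣ (fibres xs)) ⟩
  ∑ (allSubsets (n G)) (λ xs → shiftBy ∣ xs ∣ (P ⊛ fibreᶻ xs))
    ≈⟨ ∑-cong (allSubsets (n G)) (λ xs → ⊛-shiftByʳ ∣ xs ∣ P (fibreᶻ xs)) ⟨
  ∑ (allSubsets (n G)) (λ xs → P ⊛ shiftBy ∣ xs ∣ (fibreᶻ xs))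
    ≈⟨ ⊛-∑ʳ P (allSubsets (n G)) _ ⟨
  P ⊛ ∑ (allSubsets (n G)) (λ xs → shiftBy ∣ xs ∣ (fibreᶻ xs))
    ≈⟨ ⊛-congʳ P (count-split (n G) (n H) (does ∘ independent? (zykov G a H))) ⟨
  P ⊛ count (allSubsets (n G + n H)) (does ∘ independent? (zykov G a H))
    ≈⟨ ⊛-congʳ P (indPoly-count (zykov G a H)) ⟨
  P ⊛ indPoly (zykov G a H)
    ≈⟨ *P≈⊛ P (indPoly (zykov G a H)) ⟨
  (P *P indPoly (zykov G a H)) ∎
  where
  open ≈P-Reasoning
  open Fibres G H a clique
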